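{- Let $\mathcal{N}$ be a free cyclic ordering of $[5]$. Then the convex hull of the points $x(t)$, taken over the binary trees $t$ on $[5]$ that are coplanar with $\mathcal{N}$, is a facet of the BME polytope $\mathcal{P}_5$, and this facet is combinatorially equivalent to a 4-simplex (it has exactly five vertices).
   Context: A binary tree on leaf set $[n]$ is a tree whose vertices have degree 1 (leaves, labeled bijectively by $[n]$) or degree 3. For such $t$, $x(t)\in\mathbb{R}^{\binom n2}$ has coordinates $x_{ij}(t)=2^{\,n-2-l_{ij}}$, where $l_{ij}$ is the number of internal nodes on the path between leaves $i$ and $j$. The BME polytope $\mathcal{P}_n$ is the convex hull of all $x(t)$. A free cyclic ordering of $[n]$ is an arrangement of its elements around a circle, considered up to rotation and reflection. A binary tree is coplanar with the free cyclic ordering if it can be drawn in the plane without edge crossings with its leaves placed on a circle in that cyclic order (the tree lying inside the circle). A facet is a face of codimension one.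
   Formalization: The ambient space $\mathbb{R}^{\binom n2}$ is replaced by rational coordinates: the hyperplane coefficients and convex-combination weights are rational, and affine independence is tested with rational coefficients. -}

module Defs where

open import Data.Nat as ℕ using (ℕ; zero; suc; _∸_; _^_)
open import Data.Fin as Fin using (Fin; _<?_; _≟_)
open import Data.Bool using (Bool; true; false; if_then_else_; _∧_; _∨_)
open import Data.List using (List; []; _∷_; _++_; map; allFin; cartesianProduct; filter; reverse; take; drop; foldr)
open import Data.List.Relation.Binary.Permutation.Propositional using (_↭_)
open import Data.Product using (Σ; ∃; _×_; _,_; proj₁; proj₂)
open import Data.Integer using (+_)
open import Data.Rational using (ℚ; _+_; _*_; _≤_; 0ℚ; 1ℚ; _/_)
open import Relation.Binary.PropositionalEquality using (_≡_)
open import Relation.Nullary using (¬_; does)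
open import Data.Sum using (_⊎_)

data RTree (n : ℕ) : Set where
  leaf : Fin n → RTree n
  node : RTree n → RTree n → RTree n

-- An unrooted binary tree, presented with a distinguished edge joining
-- the roots of two rooted binary trees.  Every (unrooted) tree all of
-- whose vertices have degree 1 or 3, with at least 2 leaves, arises in
-- this way (cut any edge).
data UTree (n : ℕ) : Set where
  edge : RTree n → RTree n → UTree n

rleaves : ∀ {n} → RTree n → List (Fin n)
rleaves (leaf i)   = i ∷ []
rleaves (node l r) = rleaves l ++ rleaves r

leaves : ∀ {n} → UTree n → List (Fin n)
leaves (edge a b) = rleaves a ++ rleaves b

IsBinaryTree : ∀ {n} → UTree n → Set
IsBinaryTree {n} t = leaves t ↭ allFin n

-- Path lengths (number of internal nodes on the path between two leaves).

occurs : ∀ {n} → Fin n → RTree n → Bool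
occurs i (leaf j)   = does (i ≟ j)
occurs i (node l r) = occurs i l ∨ occurs i r

height : ∀ {n} → Fin n → RTree n → ℕ
height i (leaf _)   = 0
height i (node l r) = suc (if occurs i l then height i l else height i r)

rpath : ∀ {n} → Fin n → Fin n → RTree n → ℕ
rpath i j (leaf _) = 0
rpath i j (node l r) with occurs i l | occurs j l
... | true  | true  = rpath i j l
... | false | false = rpath i j r
... | true  | false = height i l ℕ.+ height j r ℕ.+ 1
... | false | true  = height i r ℕ.+ height j l ℕ.+ 1

pathLen : ∀ {n} → Fin n → Fin n → UTree n → ℕ
pathLen i j (edge a b) with occurs i a | occurs j a
... | true  | true  = rpath i j a
... | false | false = rpath i j b
... | true  | false = height i a ℕ.+ height j b
... | false | true  = height i b ℕ.+ height j a

-- Points of ℝ^(n choose 2); we use rational coordinates (all the data is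
-- rational).  A point is a function on pairs; only the coordinates with
-- i < j are meaningful.

Pt : ℕ → Set
Pt n = Fin n → Fin n → ℚ

pairs : ∀ n → List (Fin n × Fin n)
pairs n = filter (λ p → proj₁ p <? proj₂ p) (cartesianProduct (allFin n) (allFin n))

ℕtoℚ : ℕ → ℚ
ℕtoℚ m = (+ m) / 1

x : ∀ {n} → UTree n → Pt n
x {n} t i j = ℕtoℚ (2 ^ (n ∸ 2 ∸ pathLen i j t))

_≈P_ : ∀ {n} → Pt n → Pt n → Set
_≈P_ {n} p q = ∀ (i j : Fin n) → i Fin.< j → p i j ≡ q i j

sumL : List ℚ → ℚ
sumL = foldr _+_ 0ℚ

dot : ∀ {n} → Pt n → Pt n → ℚ
dot {n} c p = sumL (map (λ ij → c (proj₁ ij) (proj₂ ij) * p (proj₁ ij) (proj₂ ij)) (pairs n))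

ΣF : ∀ {k} → (Fin k → ℚ) → ℚ
ΣF {zero}  f = 0ℚ
ΣF {suc k} f = f Fin.zero + ΣF (λ a → f (Fin.suc a))

InConv : ∀ {n k} → (Fin k → Pt n) → Pt n → Set
InConv {n} {k} ps p =
  Σ (Fin k → ℚ) λ w →
    (∀ a → 0ℚ ≤ w a) × (ΣF w ≡ 1ℚ) ×
    (∀ (i j : Fin n) → i Fin.< j → ΣF (λ a → w a * ps a i j) ≡ p i j)

InConvOf : ∀ {n} → (UTree n → Set) → Pt n → Set
InConvOf {n} Q p = Σ ℕ λ k → Σ (Fin k → UTree n) λ f → (∀ a → Q (f a)) × InConv (λ a → x (f a)) p

AffinelyIndependent : ∀ {n k} → (Fin k → Pt n) → Set
AffinelyIndependent {n} {k} ps =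
  ∀ (λs : Fin k → ℚ) → ΣF λs ≡ 0ℚ →
    (∀ (i j : Fin n) → i Fin.< j → ΣF (λ a → λs a * ps a i j) ≡ 0ℚ) →
    ∀ a → λs a ≡ 0ℚ

-- The convex hull of { x(s) | Q s } has (affine) dimension d: its affine
-- hull (= affine hull of the points) has a maximal affinely independent
-- subset of size d + 1.
HasDim : ∀ {n} → (UTree n → Set) → ℕ → Set
HasDim {n} Q d =
  (Σ (Fin (suc d) → UTree n) λ f → (∀ a → Q (f a)) × AffinelyIndependent (λ a → x (f a)))
  × (∀ (f : Fin (suc (suc d)) → UTree n) → (∀ a → Q (f a)) → ¬ AffinelyIndependent (λ a → x (f a)))

-- A free cyclic ordering of [n] is represented by a list listing [n] once
-- around the circle; rotations and reflections are identified below.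
IsCyclicOrdering : ∀ {n} → List (Fin n) → Set
IsCyclicOrdering {n} N = N ↭ allFin n

ReadsAround : ∀ {n} → List (Fin n) → List (Fin n) → Set
ReadsAround l N = Σ ℕ λ k → (l ≡ drop k N ++ take k N) ⊎ (l ≡ drop k (reverse N) ++ take k (reverse N))

-- planar embeddings of a rooted tree: choose the cyclic order at every
-- internal node, i.e. possibly swap the two children
data Flip {n} : RTree n → RTree n → Set where
  leaf  : ∀ i → Flip (leaf i) (leaf i)
  keep  : ∀ {l r l' r'} → Flip l l' → Flip r r' → Flip (node l r) (node l' r')
  swap  : ∀ {l r l' r'} → Flip l l' → Flip r r' → Flip (node l r) (node r' l')

-- t can be drawn in the disk without crossings with the leaves on the
-- boundary circle in the cyclic order N: some planar embedding of t has
-- boundary leaf sequence equal to N up to rotation/reflection.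
Coplanar : ∀ {n} → List (Fin n) → UTree n → Set
Coplanar N (edge a b) =
  Σ (RTree _) λ a' → Σ (RTree _) λ b' → Flip a a' × Flip b b' × ReadsAround (rleaves a' ++ rleaves b') N

BinTreeCoplanar : ∀ {n} → List (Fin n) → UTree n → Set
BinTreeCoplanar N t = IsBinaryTree t × Coplanar N t

-- Every binary tree on five leaves is a caterpillar (two cherries and a middle leaf), so P₅ has the 15
-- caterpillars as vertices, and any question about finitely many trees reduces to a finite computation once
-- trees are enumerated by shape and leaf sequence. For a cyclic ordering N, the facet is cut out by
-- Σ_{ {i,j} a side of N } x_ij ≤ 13, which holds on all 15 vertices with equality exactly at the five caterpillars
-- whose cherries are sides of N. These five are affinely independent (they have explicit dual affine
-- functionals), while P₅ spans a five-dimensional affine space: six of its vertices are affinely independent,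
-- and the Kraft equalities Σ_{j ≠ i} x_ij = 8 express all coordinates through five of them. Trees coplanar
-- with N are reduced to N = 0 1 2 3 4 by relabelling leaves, which preserves path lengths, and every planar
-- embedding of a tree has the path lengths of the tree itself.
module Submission where

open import Defs

open import Data.Bool using (true; false; _∨_; if_then_else_)
open import Data.Empty using (⊥-elim)
open import Data.Fin as Fin using (Fin; zero; suc; #_; toℕ; punchIn; punchOut)
import Data.Fin.Properties as Fin
open import Data.Integer using (ℤ)
import Data.Integer.Literals as ℤLiterals
open import Data.List as List
  using (List; []; _∷_; _++_; map; allFin; reverse; drop; take; filter; cartesianProduct; cartesianProductWith; concatMap; length; upTo; zip)
import Data.List.Properties as List
open import Data.List.Membership.Propositional using (_∈_; find)
open import Data.List.Membership.Propositional.Properties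
open import Data.List.Relation.Unary.All as All using (All; []; _∷_; all?)
open import Data.List.Relation.Unary.Any as Any using (Any; here; there; any?)
open import Data.List.Relation.Binary.Permutation.Propositional using (_↭_; ↭-sym; ↭-trans; ↭-reflexive)
open import Data.List.Relation.Binary.Permutation.Propositional.Properties using (∈-resp-↭; ↭-length; ++-comm; ↭-reverse)
open import Data.List.Sort.InsertionSort (Fin.≤-decTotalOrder 5) using (sort)
open import Data.List.Sort.InsertionSort.Properties (Fin.≤-decTotalOrder 5) using (sort-↭)
open import Data.Nat as ℕ using (ℕ; zero; suc; z≤n; s≤s)
open import Data.Nat.DivMod using (_mod_)
import Data.Nat.Literals as ℕLiterals
import Data.Nat.Properties as ℕ
open import Data.Product using (Σ; ∃; ∃₂; _×_; _,_; proj₁; proj₂; map₂; uncurry)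
open import Data.Rational as ℚ using (ℚ; 0ℚ; 1ℚ; _+_; _*_; -_; _-_; 1/_; _/_; _≤_)
import Data.Rational.Literals as ℚLiterals
import Data.Rational.Properties as ℚ
open import Data.Rational.Solver using (module +-*-Solver)
open import Data.Sum using (inj₁; inj₂)
open import Function using (_∘_; flip)
open import Function.Definitions using (Injective)
open import Relation.Binary.PropositionalEquality
open import Relation.Nullary using (¬_; Dec; does; yes; no)
import Relation.Nullary.Decidable as Dec
open import Relation.Nullary.Decidable using (toWitness; _×-dec_; _⊎-dec_; _→-dec_)
open import Relation.Unary using (Decidable)

open +-*-Solver
open ≡-Reasoning

private
  variable
    k m n : ℕ
    A : Set

ΣF-cong : {f g : Fin k → ℚ} → (∀ a → f a ≡ g a) → ΣF f ≡ ΣF g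
ΣF-cong {zero}  eq = refl
ΣF-cong {suc k} eq = cong₂ _+_ (eq zero) (ΣF-cong (λ a → eq (suc a)))

ΣF-+ : (f g : Fin k → ℚ) → ΣF (λ a → f a + g a) ≡ ΣF f + ΣF g
ΣF-+ {zero}  f g = refl
ΣF-+ {suc k} f g = begin
  (f zero + g zero) + ΣF (λ a → f (suc a) + g (suc a))
    ≡⟨ cong ((f zero + g zero) +_) (ΣF-+ (λ a → f (suc a)) (λ a → g (suc a))) ⟩
  (f zero + g zero) + (ΣF (λ a → f (suc a)) + ΣF (λ a → g (suc a)))
    ≡⟨ solve 4 (λ a b c d → (a :+ b) :+ (c :+ d) := (a :+ c) :+ (b :+ d)) refl
         (f zero) (g zero) (ΣF (λ a → f (suc a))) (ΣF (λ a → g (suc a))) ⟩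
  (f zero + ΣF (λ a → f (suc a))) + (g zero + ΣF (λ a → g (suc a))) ∎

ΣF-*ˡ : (c : ℚ) (f : Fin k → ℚ) → ΣF (λ a → c * f a) ≡ c * ΣF f
ΣF-*ˡ {zero}  c f = sym (ℚ.*-zeroʳ c)
ΣF-*ˡ {suc k} c f = begin
  c * f zero + ΣF (λ a → c * f (suc a)) ≡⟨ cong (c * f zero +_) (ΣF-*ˡ c (λ a → f (suc a))) ⟩
  c * f zero + c * ΣF (λ a → f (suc a)) ≡⟨ ℚ.*-distribˡ-+ c (f zero) _ ⟨
  c * (f zero + ΣF (λ a → f (suc a)))   ∎

ΣF-zero : {f : Fin k → ℚ} → (∀ a → f a ≡ 0ℚ) → ΣF f ≡ 0ℚ
ΣF-zero {zero}  eq = refl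
ΣF-zero {suc k} eq = trans (cong₂ _+_ (eq zero) (ΣF-zero (λ a → eq (suc a)))) (ℚ.+-identityˡ 0ℚ)

δ : Fin k → Fin k → ℚ
δ zero    zero    = 1ℚ
δ zero    (suc _) = 0ℚ
δ (suc _) zero    = 0ℚ
δ (suc a) (suc b) = δ a b

δ-diagonal : (a : Fin k) → δ a a ≡ 1ℚ
δ-diagonal zero    = refl
δ-diagonal (suc a) = δ-diagonal a

δ-offDiagonal : {a b : Fin k} → a ≢ b → δ a b ≡ 0ℚ
δ-offDiagonal {a = zero}  {zero}  a≢b = ⊥-elim (a≢b refl)
δ-offDiagonal {a = zero}  {suc b} a≢b = refl
δ-offDiagonal {a = suc a} {zero}  a≢b = refl
δ-offDiagonal {a = suc a} {suc b} a≢b = δ-offDiagonal (a≢b ∘ cong suc)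

ΣF-δ : (a : Fin k) (g : Fin k → ℚ) → ΣF (λ b → δ a b * g b) ≡ g a
ΣF-δ {suc k} zero g = begin
  1ℚ * g zero + ΣF (λ b → 0ℚ * g (suc b)) ≡⟨ cong₂ _+_ (ℚ.*-identityˡ (g zero)) (ΣF-zero (λ b → ℚ.*-zeroˡ (g (suc b)))) ⟩
  g zero + 0ℚ                             ≡⟨ ℚ.+-identityʳ (g zero) ⟩
  g zero                                  ∎
ΣF-δ {suc k} (suc a) g = begin
  0ℚ * g zero + ΣF (λ b → δ a b * g (suc b)) ≡⟨ cong₂ _+_ (ℚ.*-zeroˡ (g zero)) (ΣF-δ a (λ b → g (suc b))) ⟩
  0ℚ + g (suc a)                             ≡⟨ ℚ.+-identityˡ (g (suc a)) ⟩
  g (suc a)                                  ∎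

infix 4 _⊕_
record Affine (I : Set) : Set where
  constructor _⊕_
  field
    terms    : List (ℚ × I)
    constant : ℚ
open Affine public

linear : {I : Set} → List (ℚ × I) → (I → ℚ) → ℚ
linear []             y = 0ℚ
linear ((w , i) ∷ ts) y = w * y i + linear ts y

eval : {I : Set} → Affine I → (I → ℚ) → ℚ
eval ℓ y = linear (terms ℓ) y + constant ℓ

eval-cong : {I : Set} (ℓ : Affine I) {y y′ : I → ℚ} → (∀ i → y i ≡ y′ i) → eval ℓ y ≡ eval ℓ y′
eval-cong (ts ⊕ c) y≡y′ = cong (_+ c) (linear-cong ts)
  where
  linear-cong : ∀ ts → linear ts _ ≡ linear ts _
  linear-cong []             = refl
  linear-cong ((w , i) ∷ ts) = cong₂ _+_ (cong (w *_) (y≡y′ i)) (linear-cong ts)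

linear-combination : {I : Set} (ts : List (ℚ × I)) (λs : Fin k → ℚ) (y : Fin k → I → ℚ) →
  ΣF (λ b → λs b * linear ts (y b)) ≡ linear ts (λ i → ΣF (λ b → λs b * y b i))
linear-combination []             λs y = ΣF-zero (λ b → ℚ.*-zeroʳ (λs b))
linear-combination {k = k} ((w , i) ∷ ts) λs y = begin
  ΣF (λ b → λs b * (w * y b i + linear ts (y b)))
    ≡⟨ ΣF-cong (λ b → solve 4 (λ l w y r → l :* (w :* y :+ r) := w :* (l :* y) :+ l :* r) refl
                        (λs b) w (y b i) (linear ts (y b))) ⟩
  ΣF (λ b → w * (λs b * y b i) + λs b * linear ts (y b))
    ≡⟨ ΣF-+ {k} _ _ ⟩
  ΣF (λ b → w * (λs b * y b i)) + ΣF (λ b → λs b * linear ts (y b))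
    ≡⟨ cong₂ _+_ (ΣF-*ˡ {k} w _) (linear-combination ts λs y) ⟩
  w * ΣF (λ b → λs b * y b i) + linear ts (λ i → ΣF (λ b → λs b * y b i)) ∎

eval-affineCombination : {I : Set} (ℓ : Affine I) (λs : Fin k → ℚ) (y : Fin k → I → ℚ) → ΣF λs ≡ 0ℚ →
  ΣF (λ b → λs b * eval ℓ (y b)) ≡ linear (terms ℓ) (λ i → ΣF (λ b → λs b * y b i))
eval-affineCombination {k = k} (ts ⊕ c) λs y Σλs≡0 = begin
  ΣF (λ b → λs b * (linear ts (y b) + c))
    ≡⟨ ΣF-cong (λ b → solve 3 (λ l r c → l :* (r :+ c) := l :* r :+ c :* l) refl (λs b) (linear ts (y b)) c) ⟩
  ΣF (λ b → λs b * linear ts (y b) + c * λs b)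
    ≡⟨ ΣF-+ {k} _ _ ⟩
  ΣF (λ b → λs b * linear ts (y b)) + ΣF (λ b → c * λs b)
    ≡⟨ cong₂ _+_ (linear-combination ts λs y) (trans (ΣF-*ˡ c λs) (trans (cong (c *_) Σλs≡0) (ℚ.*-zeroʳ c))) ⟩
  linear ts (λ i → ΣF (λ b → λs b * y b i)) + 0ℚ
    ≡⟨ ℚ.+-identityʳ _ ⟩
  linear ts (λ i → ΣF (λ b → λs b * y b i)) ∎

linear-vanishing : {I : Set} {y : I → ℚ} {ts : List (ℚ × I)} → All (λ t → y (proj₂ t) ≡ 0ℚ) ts → linear ts y ≡ 0ℚ
linear-vanishing []                  = refl
linear-vanishing {ts = (w , _) ∷ _} (y≡0 ∷ rest) =
  trans (cong₂ _+_ (trans (cong (w *_) y≡0) (ℚ.*-zeroʳ w)) (linear-vanishing rest)) (ℚ.+-identityˡ 0ℚ)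

coordinates : Pt n → Fin n × Fin n → ℚ
coordinates p (i , j) = p i j

Ordered : Fin n × Fin n → Set
Ordered (i , j) = i Fin.< j

IsDualBasis : (ps : Fin k → Pt n) → (Fin k → Affine (Fin n × Fin n)) → Set
IsDualBasis ps ℓ = ∀ a → All (λ t → Ordered (proj₂ t)) (terms (ℓ a)) × (∀ b → eval (ℓ a) (coordinates (ps b)) ≡ δ a b)

isDualBasis? : (ps : Fin k → Pt n) (ℓ : Fin k → Affine (Fin n × Fin n)) → Dec (IsDualBasis ps ℓ)
isDualBasis? ps ℓ = Fin.all? λ a →
  All.all? (λ t → proj₁ (proj₂ t) Fin.<? proj₂ (proj₂ t)) (terms (ℓ a)) ×-dec
  Fin.all? (λ b → eval (ℓ a) (coordinates (ps b)) ℚ.≟ δ a b)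

affinelyIndependent-dualBasis : (ps : Fin k → Pt n) (ℓ : Fin k → Affine (Fin n × Fin n)) →
  IsDualBasis ps ℓ → AffinelyIndependent ps
affinelyIndependent-dualBasis ps ℓ dual λs Σλs≡0 combination≡0 a = begin
  λs a                                                 ≡⟨ ΣF-δ a λs ⟨
  ΣF (λ b → δ a b * λs b)                              ≡⟨ ΣF-cong (λ b → trans (cong (_* λs b) (sym (proj₂ (dual a) b))) (ℚ.*-comm _ (λs b))) ⟩
  ΣF (λ b → λs b * eval (ℓ a) (coordinates (ps b)))    ≡⟨ eval-affineCombination (ℓ a) λs (λ b → coordinates (ps b)) Σλs≡0 ⟩
  linear (terms (ℓ a)) (λ q → ΣF (λ b → λs b * coordinates (ps b) q))
                                                       ≡⟨ linear-vanishing (All.map (λ {t} → combination≡0 (proj₁ (proj₂ t)) (proj₂ (proj₂ t))) (proj₁ (dual a))) ⟩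
  0ℚ                                                   ∎

¬affinelyIndependent-repeated : (ps : Fin k → Pt n) {a a′ : Fin k} → a ≢ a′ → ps a ≈P ps a′ → ¬ AffinelyIndependent ps
¬affinelyIndependent-repeated {k} ps {a} {a′} a≢a′ ps-a≈ps-a′ independent = 1≢0 (begin
  1ℚ                  ≡⟨ cong₂ _-_ (δ-diagonal a) (δ-offDiagonal (a≢a′ ∘ sym)) ⟨
  δ a a - δ a′ a      ≡⟨ independent λs Σλs≡0 combination≡0 a ⟩
  0ℚ                  ∎)
  where
  λs : Fin k → ℚ
  λs c = δ a c - δ a′ c
  ΣF-difference : (g : Fin k → ℚ) → ΣF (λ c → λs c * g c) ≡ g a - g a′
  ΣF-difference g = begin
    ΣF (λ c → (δ a c - δ a′ c) * g c)
      ≡⟨ ΣF-cong (λ c → solve 3 (λ d d′ x → (d :- d′) :* x := d :* x :+ (:- con 1ℚ) :* (d′ :* x)) refl (δ a c) (δ a′ c) (g c)) ⟩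
    ΣF (λ c → δ a c * g c + (- 1ℚ) * (δ a′ c * g c))
      ≡⟨ ΣF-+ {k} _ _ ⟩
    ΣF (λ c → δ a c * g c) + ΣF (λ c → (- 1ℚ) * (δ a′ c * g c))
      ≡⟨ cong₂ _+_ (ΣF-δ a g) (trans (ΣF-*ˡ {k} (- 1ℚ) _) (cong ((- 1ℚ) *_) (ΣF-δ a′ g))) ⟩
    g a + (- 1ℚ) * g a′
      ≡⟨ solve 2 (λ x y → x :+ (:- con 1ℚ) :* y := x :- y) refl (g a) (g a′) ⟩
    g a - g a′ ∎
  Σλs≡0 : ΣF λs ≡ 0ℚ
  Σλs≡0 = trans (ΣF-cong (λ c → sym (ℚ.*-identityʳ (λs c)))) (trans (ΣF-difference (λ _ → 1ℚ)) (ℚ.+-inverseʳ 1ℚ))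
  combination≡0 : ∀ i j → i Fin.< j → ΣF (λ c → λs c * ps c i j) ≡ 0ℚ
  combination≡0 i j i<j = trans (ΣF-difference (λ c → ps c i j))
    (trans (cong (λ z → ps a i j - z) (sym (ps-a≈ps-a′ i j i<j))) (ℚ.+-inverseʳ (ps a i j)))
  1≢0 : 1ℚ ≢ 0ℚ
  1≢0 ()

affinelyIndependent-injective : (ps : Fin k → Pt n) → AffinelyIndependent ps → ∀ a a′ → ps a ≈P ps a′ → a ≡ a′
affinelyIndependent-injective ps independent a a′ same with a Fin.≟ a′
... | yes a≡a′ = a≡a′
... | no a≢a′  = ⊥-elim (¬affinelyIndependent-repeated ps a≢a′ same independent)

IsRelation : (Fin k → Fin m → ℚ) → (Fin k → ℚ) → Set
IsRelation v l = ∀ i → ΣF (λ a → l a * v a i) ≡ 0ℚ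

NonTrivial : (Fin k → ℚ) → Set
NonTrivial l = ∃ λ a → l a ≢ 0ℚ

-- Gaussian elimination: pivot on the i₀-th coordinate of the first vector.
module Elimination (v : Fin (suc (suc m)) → Fin (suc m) → ℚ) (i₀ : Fin (suc m)) (pivot≢0 : v zero i₀ ≢ 0ℚ) where

  private
    instance
      pivot-nonZero : ℚ.NonZero (v zero i₀)
      pivot-nonZero = ℚ.≢-nonZero pivot≢0

  factor : Fin (suc m) → ℚ
  factor b = v (suc b) i₀ * 1/ v zero i₀

  reduced : Fin (suc m) → Fin m → ℚ
  reduced b j = v (suc b) (punchIn i₀ j) - factor b * v zero (punchIn i₀ j)

  lift : (Fin (suc m) → ℚ) → Fin (suc (suc m)) → ℚ
  lift μ zero    = - ΣF (λ b → μ b * factor b)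
  lift μ (suc b) = μ b

  module _ (μ : Fin (suc m) → ℚ) where

    private
      ΣF-*ʳ : (f : Fin (suc m) → ℚ) (c : ℚ) → ΣF (λ b → f b * c) ≡ ΣF f * c
      ΣF-*ʳ f c = trans (ΣF-cong (λ b → ℚ.*-comm (f b) c)) (trans (ΣF-*ˡ c f) (ℚ.*-comm c (ΣF f)))

      cancel : ∀ b → μ b * factor b * v zero i₀ ≡ μ b * v (suc b) i₀
      cancel b = begin
        μ b * (v (suc b) i₀ * 1/ v zero i₀) * v zero i₀
          ≡⟨ solve 4 (λ m x q p → m :* (x :* q) :* p := m :* x :* (q :* p)) refl (μ b) (v (suc b) i₀) (1/ v zero i₀) (v zero i₀) ⟩
        μ b * v (suc b) i₀ * (1/ v zero i₀ * v zero i₀)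
          ≡⟨ cong (μ b * v (suc b) i₀ *_) (ℚ.*-inverseˡ (v zero i₀)) ⟩
        μ b * v (suc b) i₀ * 1ℚ
          ≡⟨ ℚ.*-identityʳ _ ⟩
        μ b * v (suc b) i₀ ∎

    lift-relation-pivot : ΣF (λ a → lift μ a * v a i₀) ≡ 0ℚ
    lift-relation-pivot = begin
      - ΣF (λ b → μ b * factor b) * v zero i₀ + ΣF (λ b → μ b * v (suc b) i₀)
        ≡⟨ cong (_+ ΣF (λ b → μ b * v (suc b) i₀)) (ℚ.neg-distribˡ-* (ΣF (λ b → μ b * factor b)) (v zero i₀)) ⟨
      - (ΣF (λ b → μ b * factor b) * v zero i₀) + ΣF (λ b → μ b * v (suc b) i₀)
        ≡⟨ cong (λ s → - s + ΣF (λ b → μ b * v (suc b) i₀)) (trans (sym (ΣF-*ʳ (λ b → μ b * factor b) (v zero i₀))) (ΣF-cong cancel)) ⟩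
      - ΣF (λ b → μ b * v (suc b) i₀) + ΣF (λ b → μ b * v (suc b) i₀)
        ≡⟨ ℚ.+-inverseˡ (ΣF (λ b → μ b * v (suc b) i₀)) ⟩
      0ℚ ∎

    lift-relation-other : IsRelation reduced μ → ∀ {i} → i ≢ i₀ → ΣF (λ a → lift μ a * v a i) ≡ 0ℚ
    lift-relation-other relation {i} i≢i₀ = begin
      - ΣF (λ b → μ b * factor b) * v zero i + ΣF (λ b → μ b * v (suc b) i)
        ≡⟨ solve 3 (λ s x t → (:- s) :* x :+ t := t :+ (:- x) :* s) refl (ΣF (λ b → μ b * factor b)) (v zero i) _ ⟩
      ΣF (λ b → μ b * v (suc b) i) + (- v zero i) * ΣF (λ b → μ b * factor b)
        ≡⟨ cong (ΣF (λ b → μ b * v (suc b) i) +_) (ΣF-*ˡ (- v zero i) (λ b → μ b * factor b)) ⟨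
      ΣF (λ b → μ b * v (suc b) i) + ΣF (λ b → (- v zero i) * (μ b * factor b))
        ≡⟨ ΣF-+ (λ b → μ b * v (suc b) i) (λ b → (- v zero i) * (μ b * factor b)) ⟨
      ΣF (λ b → μ b * v (suc b) i + (- v zero i) * (μ b * factor b))
        ≡⟨ ΣF-cong (λ b → solve 4 (λ m x y f → m :* x :+ (:- y) :* (m :* f) := m :* (x :- f :* y)) refl (μ b) (v (suc b) i) (v zero i) (factor b)) ⟩
      ΣF (λ b → μ b * (v (suc b) i - factor b * v zero i))
        ≡⟨ ΣF-cong (λ b → cong (λ i′ → μ b * (v (suc b) i′ - factor b * v zero i′)) (Fin.punchIn-punchOut i₀≢i)) ⟨
      ΣF (λ b → μ b * reduced b (punchOut i₀≢i))
        ≡⟨ relation (punchOut i₀≢i) ⟩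
      0ℚ ∎
      where
      i₀≢i = i≢i₀ ∘ sym

    lift-relation : IsRelation reduced μ → IsRelation v (lift μ)
    lift-relation relation i with i Fin.≟ i₀
    ... | yes refl  = lift-relation-pivot
    ... | no i≢i₀ = lift-relation-other relation i≢i₀

linearDependence : ∀ m (v : Fin (suc m) → Fin m → ℚ) → ∃ λ l → NonTrivial l × IsRelation v l
linearDependence zero    v = (λ _ → 1ℚ) , (zero , λ ()) , λ ()
linearDependence (suc m) v with Fin.all? (λ i → v zero i ℚ.≟ 0ℚ)
... | yes first≡0 = δ zero , (zero , λ ()) , λ i → trans (ΣF-δ zero (λ a → v a i)) (first≡0 i)
... | no first≢0 =
  let i₀ , pivot≢0 = Fin.¬∀⟶∃¬ (suc m) _ (λ i → v zero i ℚ.≟ 0ℚ) first≢0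
      open Elimination v i₀ pivot≢0
      μ , (b , μb≢0) , relation = linearDependence m reduced
  in lift μ , (suc b , μb≢0) , lift-relation μ relation

-- A relation among the vectors (1, y) is an affine relation that also kills every affine function of y.
¬affinelyIndependent-parametrised : (π : Fin m → Fin n × Fin n) (φ : Fin n → Fin n → Affine (Fin m))
  (ps : Fin (suc (suc m)) → Pt n) →
  (∀ a i j → i Fin.< j → ps a i j ≡ eval (φ i j) (coordinates (ps a) ∘ π)) →
  ¬ AffinelyIndependent ps
¬affinelyIndependent-parametrised {m} π φ ps parametrised independent
  with linearDependence (suc m) (λ a → λ { zero → 1ℚ ; (suc p) → coordinates (ps a) (π p) })
... | l , (a , l≢0) , relation = l≢0 (independent l Σl≡0 combination≡0 a)
  where
  Σl≡0 : ΣF l ≡ 0ℚ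
  Σl≡0 = trans (ΣF-cong (λ b → sym (ℚ.*-identityʳ (l b)))) (relation zero)
  combination≡0 : ∀ i j → i Fin.< j → ΣF (λ b → l b * ps b i j) ≡ 0ℚ
  combination≡0 i j i<j = begin
    ΣF (λ b → l b * ps b i j)                                   ≡⟨ ΣF-cong (λ b → cong (l b *_) (parametrised b i j i<j)) ⟩
    ΣF (λ b → l b * eval (φ i j) (coordinates (ps b) ∘ π))      ≡⟨ eval-affineCombination (φ i j) l (λ b → coordinates (ps b) ∘ π) Σl≡0 ⟩
    linear (terms (φ i j)) (λ p → ΣF (λ b → l b * coordinates (ps b) (π p)))
                                                                ≡⟨ linear-vanishing {ts = terms (φ i j)} (All.tabulate (λ {t} _ → relation (suc (proj₂ t)))) ⟩
    0ℚ                                                          ∎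

mapR : (Fin n → Fin n) → RTree n → RTree n
mapR σ (leaf i)   = leaf (σ i)
mapR σ (node l r) = node (mapR σ l) (mapR σ r)

mapU : (Fin n → Fin n) → UTree n → UTree n
mapU σ (edge a b) = edge (mapR σ a) (mapR σ b)

rleaves-map : ∀ σ (r : RTree n) → rleaves (mapR σ r) ≡ map σ (rleaves r)
rleaves-map σ (leaf _)   = refl
rleaves-map σ (node l r) = trans (cong₂ _++_ (rleaves-map σ l) (rleaves-map σ r)) (sym (List.map-++ σ (rleaves l) (rleaves r)))

leaves-map : ∀ σ (t : UTree n) → leaves (mapU σ t) ≡ map σ (leaves t)
leaves-map σ (edge a b) = trans (cong₂ _++_ (rleaves-map σ a) (rleaves-map σ b)) (sym (List.map-++ σ (rleaves a) (rleaves b)))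

Flip-map : ∀ σ {a a′ : RTree n} → Flip a a′ → Flip (mapR σ a) (mapR σ a′)
Flip-map σ (leaf i)   = leaf (σ i)
Flip-map σ (keep f g) = keep (Flip-map σ f) (Flip-map σ g)
Flip-map σ (swap f g) = swap (Flip-map σ f) (Flip-map σ g)

Flip-sym : {a a′ : RTree n} → Flip a a′ → Flip a′ a
Flip-sym (leaf i)   = leaf i
Flip-sym (keep f g) = keep (Flip-sym f) (Flip-sym g)
Flip-sym (swap f g) = swap (Flip-sym g) (Flip-sym f)

module _ {σ : Fin n → Fin n} (σ-injective : Injective _≡_ _≡_ σ) where

  occurs-map : ∀ i r → occurs (σ i) (mapR σ r) ≡ occurs i r
  occurs-map i (leaf j) with σ i Fin.≟ σ j | i Fin.≟ j
  ... | yes _    | yes _    = refl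
  ... | no _     | no _     = refl
  ... | yes σi≡σj | no i≢j  = ⊥-elim (i≢j (σ-injective σi≡σj))
  ... | no σi≢σj | yes i≡j  = ⊥-elim (σi≢σj (cong σ i≡j))
  occurs-map i (node l r) = cong₂ _∨_ (occurs-map i l) (occurs-map i r)

  height-map : ∀ i r → height (σ i) (mapR σ r) ≡ height i r
  height-map i (leaf _) = refl
  height-map i (node l r) rewrite occurs-map i l with occurs i l
  ... | true  = cong suc (height-map i l)
  ... | false = cong suc (height-map i r)

  rpath-map : ∀ i j r → rpath (σ i) (σ j) (mapR σ r) ≡ rpath i j r
  rpath-map i j (leaf _) = refl
  rpath-map i j (node l r) rewrite occurs-map i l | occurs-map j l with occurs i l | occurs j l
  ... | true  | true  = rpath-map i j l
  ... | false | false = rpath-map i j r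
  ... | true  | false = cong₂ (λ hᵢ hⱼ → hᵢ ℕ.+ hⱼ ℕ.+ 1) (height-map i l) (height-map j r)
  ... | false | true  = cong₂ (λ hᵢ hⱼ → hᵢ ℕ.+ hⱼ ℕ.+ 1) (height-map i r) (height-map j l)

  pathLen-map : ∀ i j t → pathLen (σ i) (σ j) (mapU σ t) ≡ pathLen i j t
  pathLen-map i j (edge a b) rewrite occurs-map i a | occurs-map j a with occurs i a | occurs j a
  ... | true  | true  = rpath-map i j a
  ... | false | false = rpath-map i j b
  ... | true  | false = cong₂ ℕ._+_ (height-map i a) (height-map j b)
  ... | false | true  = cong₂ ℕ._+_ (height-map i b) (height-map j a)

infix 4 _≋_
record _≋_ (t s : UTree n) : Set where
  constructor mk≋
  field
    pathLen-≡ : ∀ i j → pathLen i j t ≡ pathLen i j s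
open _≋_ public

_≋?_ : (t s : UTree n) → Dec (t ≋ s)
t ≋? s = Dec.map′ mk≋ pathLen-≡ (Fin.all? (λ i → Fin.all? (λ j → pathLen i j t ℕ.≟ pathLen i j s)))

≋-trans : {t s u : UTree n} → t ≋ s → s ≋ u → t ≋ u
≋-trans t≋s s≋u = mk≋ (λ i j → trans (pathLen-≡ t≋s i j) (pathLen-≡ s≋u i j))

≋-x : {t s : UTree n} → t ≋ s → ∀ i j → x t i j ≡ x s i j
≋-x {n} t≋s i j = cong (λ l → ℕtoℚ (2 ℕ.^ (n ℕ.∸ 2 ℕ.∸ l))) (pathLen-≡ t≋s i j)

≋⇒≈P : {t s : UTree n} → t ≋ s → x t ≈P x s
≋⇒≈P t≋s i j _ = ≋-x t≋s i j

≋-unmap : {σ : Fin n → Fin n} → Injective _≡_ _≡_ σ → {t s : UTree n} → mapU σ t ≋ mapU σ s → t ≋ s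
≋-unmap σ-injective {t} {s} σt≋σs = mk≋ λ i j →
  trans (sym (pathLen-map σ-injective i j t)) (trans (pathLen-≡ σt≋σs _ _) (pathLen-map σ-injective i j s))

dot-cong : (c : Pt n) {p q : Pt n} → (∀ i j → p i j ≡ q i j) → dot c p ≡ dot c q
dot-cong {n} c p≡q = cong sumL (List.map-cong (λ (i , j) → cong (c i j *_) (p≡q i j)) (pairs n))

inConvOf-member : (Q : UTree n → Set) {s : UTree n} → Q s → {p : Pt n} → p ≈P x s → InConvOf Q p
inConvOf-member Q {s} s∈Q p≈xs = 1 , (λ _ → s) , (λ _ → s∈Q) , (λ _ → 1ℚ) , (λ _ → ℚ.nonNegative⁻¹ 1ℚ) , ℚ.+-identityʳ 1ℚ ,
  λ i j i<j → trans (ℚ.+-identityʳ _) (trans (ℚ.*-identityˡ _) (sym (p≈xs i j i<j)))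

data Shape : Set where
  ∙   : Shape
  _⊗_ : Shape → Shape → Shape

size : Shape → ℕ
size ∙       = 1
size (a ⊗ b) = size a ℕ.+ size b

shape : RTree n → Shape
shape (leaf _)   = ∙
shape (node l r) = shape l ⊗ shape r

size-shape : (r : RTree n) → size (shape r) ≡ length (rleaves r)
size-shape (leaf _)   = refl
size-shape (node l r) = trans (cong₂ ℕ._+_ (size-shape l) (size-shape r)) (sym (List.length-++ (rleaves l)))

size-positive : ∀ s → 0 ℕ.< size s
size-positive ∙       = s≤s z≤n
size-positive (a ⊗ b) = ℕ.<-≤-trans (size-positive a) (ℕ.m≤m+n (size a) (size b))

shapesUpTo : ℕ → List Shape
shapesUpTo zero    = []
shapesUpTo (suc m) = ∙ ∷ filter (λ s → size s ℕ.≤? suc m) (cartesianProductWith _⊗_ (shapesUpTo m) (shapesUpTo m))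

∈-shapesUpTo : ∀ {m} s → size s ℕ.≤ m → s ∈ shapesUpTo m
∈-shapesUpTo {zero}  s       s≤0 = ⊥-elim (ℕ.<-irrefl refl (ℕ.<-≤-trans (size-positive s) s≤0))
∈-shapesUpTo {suc m} ∙       _   = here refl
∈-shapesUpTo {suc m} (a ⊗ b) ab≤ = there (∈-filter⁺ (λ s → size s ℕ.≤? suc m)
  (∈-cartesianProductWith⁺ _⊗_ (∈-shapesUpTo a a≤m) (∈-shapesUpTo b b≤m)) ab≤)
  where
  a≤m : size a ℕ.≤ m
  a≤m = ℕ.s≤s⁻¹ (ℕ.<-≤-trans (ℕ.m<m+n (size a) (size-positive b)) ab≤)
  b≤m : size b ℕ.≤ m
  b≤m = ℕ.s≤s⁻¹ (ℕ.<-≤-trans (ℕ.m<n+m (size b) (size-positive a)) ab≤)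

shapePairs : ℕ → List (Shape × Shape)
shapePairs m = filter (λ (a , b) → size a ℕ.+ size b ℕ.≟ m) (cartesianProduct (shapesUpTo m) (shapesUpTo m))

∈-shapePairs : ∀ {m} a b → size a ℕ.+ size b ≡ m → (a , b) ∈ shapePairs m
∈-shapePairs {m} a b ab≡m = ∈-filter⁺ (λ (a , b) → size a ℕ.+ size b ℕ.≟ m)
  (∈-cartesianProduct⁺ (∈-shapesUpTo a (subst (size a ℕ.≤_) ab≡m (ℕ.m≤m+n (size a) (size b))))
                       (∈-shapesUpTo b (subst (size b ℕ.≤_) ab≡m (ℕ.m≤n+m (size b) (size a)))))
  ab≡m

module _ {n : ℕ} where

  -- `leaf zero` on running out of labels is never reached: only leaf sequences of the right length are used.
  fill : Shape → List (Fin (suc n)) → RTree (suc n) × List (Fin (suc n))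
  fill ∙       []       = leaf zero , []
  fill ∙       (i ∷ is) = leaf i , is
  fill (a ⊗ b) is       =
    let l , is′ = fill a is
        r , is″ = fill b is′
    in node l r , is″

  fill-shape : ∀ r rest → fill (shape r) (rleaves r ++ rest) ≡ (r , rest)
  fill-shape (leaf i)   rest = refl
  fill-shape (node l r) rest
    rewrite List.++-assoc (rleaves l) (rleaves r) rest
          | fill-shape l (rleaves r ++ rest)
          | fill-shape r rest = refl

  fillU : Shape × Shape → List (Fin (suc n)) → UTree (suc n)
  fillU (a , b) is = let l , is′ = fill a is in edge l (proj₁ (fill b is′))

  fillU-shape : ∀ a b → fillU (shape a , shape b) (leaves (edge a b)) ≡ edge a b
  fillU-shape a b
    rewrite fill-shape a (rleaves b)
          | sym (List.++-identityʳ (rleaves b))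
          | fill-shape b [] = refl

words : List A → ℕ → List (List A)
words ys zero    = [] ∷ []
words ys (suc k) = cartesianProductWith _∷_ ys (words ys k)

∈-words : {ys xs : List A} → All (_∈ ys) xs → xs ∈ words ys (length xs)
∈-words []           = here refl
∈-words (x∈ys ∷ xs∈) = ∈-cartesianProductWith⁺ _∷_ x∈ys (∈-words xs∈)

Covers : List (Fin n) → Set
Covers xs = ∀ i → i ∈ xs

covers? : Decidable (Covers {n})
covers? xs = Fin.all? (λ i → Any.any? (i Fin.≟_) xs)

length-↭allFin : {xs : List (Fin n)} → xs ↭ allFin n → length xs ≡ n
length-↭allFin xs↭ = trans (↭-length xs↭) (List.length-tabulate (λ i → i))

permutations : ∀ n → List (List (Fin n))
permutations n = filter covers? (words (allFin n) n)

∈-permutations : {xs : List (Fin n)} → xs ↭ allFin n → xs ∈ permutations n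
∈-permutations {n} {xs} xs↭ = ∈-filter⁺ covers?
  (subst (λ k → xs ∈ words (allFin n) k) (length-↭allFin xs↭) (∈-words (All.tabulate (λ _ → ∈-allFin _))))
  (λ i → ∈-resp-↭ (↭-sym xs↭) (∈-allFin i))

treesOver : List (List (Fin (suc n))) → List (UTree (suc n))
treesOver {n} Ls = concatMap (λ s → map (fillU s) Ls) (shapePairs (suc n))

∈-treesOver : {Ls : List (List (Fin (suc n)))} (t : UTree (suc n)) →
  length (leaves t) ≡ suc n → leaves t ∈ Ls → t ∈ treesOver Ls
∈-treesOver {n} {Ls = Ls} (edge a b) length≡ leaves∈ = ∈-concatMap⁺ (λ s → map (fillU s) Ls) {xs = shapePairs (suc n)} (Any.map (λ { refl → t∈ }) shape∈)
  where
  shape∈ : (shape a , shape b) ∈ shapePairs (suc n)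
  shape∈ = ∈-shapePairs (shape a) (shape b)
    (trans (cong₂ ℕ._+_ (size-shape a) (size-shape b)) (trans (sym (List.length-++ (rleaves a))) length≡))
  t∈ : edge a b ∈ map (fillU (shape a , shape b)) Ls
  t∈ = subst (_∈ map (fillU (shape a , shape b)) Ls) (fillU-shape a b) (∈-map⁺ (fillU (shape a , shape b)) leaves∈)

binaryTrees : ∀ n → List (UTree (suc n))
binaryTrees n = treesOver (permutations (suc n))

∈-binaryTrees : {t : UTree (suc n)} → IsBinaryTree t → t ∈ binaryTrees n
∈-binaryTrees {t = t} t-binary = ∈-treesOver t (length-↭allFin t-binary) (∈-permutations t-binary)

flips : RTree n → List (RTree n)
flips (leaf i)   = leaf i ∷ []
flips (node l r) = cartesianProductWith node (flips l) (flips r) ++ cartesianProductWith (flip node) (flips l) (flips r)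

∈-flips : {a a′ : RTree n} → Flip a a′ → a′ ∈ flips a
∈-flips (leaf i) = here refl
∈-flips (keep f g) = ∈-++⁺ˡ (∈-cartesianProductWith⁺ node (∈-flips f) (∈-flips g))
∈-flips {a = node l r} (swap f g) =
  ∈-++⁺ʳ (cartesianProductWith node (flips l) (flips r)) (∈-cartesianProductWith⁺ (flip node) (∈-flips f) (∈-flips g))

edgeFlips : UTree n → List (UTree n)
edgeFlips (edge a b) = cartesianProductWith edge (flips a) (flips b)

∈-edgeFlips : {a a′ b b′ : RTree n} → Flip a a′ → Flip b b′ → edge a′ b′ ∈ edgeFlips (edge a b)
∈-edgeFlips f g = ∈-cartesianProductWith⁺ edge (∈-flips f) (∈-flips g)

Flip-refl : (a : RTree n) → Flip a a
Flip-refl (leaf i)   = leaf i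
Flip-refl (node l r) = keep (Flip-refl l) (Flip-refl r)

coplanar-reading : {N : List (Fin n)} (t : UTree n) → ReadsAround (leaves t) N → Coplanar N t
coplanar-reading (edge a b) reads = a , b , Flip-refl a , Flip-refl b , reads

rotate : ℕ → List A → List A
rotate k xs = drop k xs ++ take k xs

rotate-↭ : ∀ k (xs : List A) → rotate k xs ↭ xs
rotate-↭ k xs = ↭-trans (++-comm (drop k xs) (take k xs)) (↭-reflexive (List.take++drop≡id k xs))

length-rotate : ∀ k (xs : List A) → length (rotate k xs) ≡ length xs
length-rotate k xs = ↭-length (rotate-↭ k xs)

rotate-map : ∀ (f : A → A) k xs → map f (rotate k xs) ≡ rotate k (map f xs)
rotate-map f k xs = trans (List.map-++ f (drop k xs) (take k xs)) (sym (cong₂ _++_ (List.drop-map k xs) (List.take-map k xs)))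

rotate-all : ∀ k (xs : List A) → length xs ℕ.≤ k → rotate k xs ≡ xs
rotate-all k xs len≤k = trans (cong (_++ take k xs) (List.drop-all k xs len≤k)) (List.take-all k xs len≤k)

rotations : List A → List (List A)
rotations xs = map (flip rotate xs) (upTo (suc (length xs)))

∈-rotations : ∀ k (xs : List A) → rotate k xs ∈ rotations xs
∈-rotations k xs with k ℕ.≤? length xs
... | yes k≤len = ∈-map⁺ (flip rotate xs) (∈-upTo⁺ (s≤s k≤len))
... | no k≰len  = subst (_∈ rotations xs) (trans (rotate-all (length xs) xs ℕ.≤-refl) (sym (rotate-all k xs (ℕ.≰⇒≥ k≰len))))
                    (∈-map⁺ (flip rotate xs) (∈-upTo⁺ {i = length xs} ℕ.≤-refl))

readings : List A → List (List A)
readings N = rotations N ++ rotations (reverse N)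

∈-readings : {l N : List (Fin n)} → ReadsAround l N → l ∈ readings N
∈-readings {N = N} (k , inj₁ refl) = ∈-++⁺ˡ (∈-rotations k N)
∈-readings {N = N} (k , inj₂ refl) = ∈-++⁺ʳ (rotations N) (∈-rotations k (reverse N))

ReadsAround-map : (f : Fin n → Fin n) {l N : List (Fin n)} → ReadsAround l N → ReadsAround (map f l) (map f N)
ReadsAround-map f {N = N} (k , inj₁ refl) = k , inj₁ (rotate-map f k N)
ReadsAround-map f {N = N} (k , inj₂ refl) = k , inj₂ (trans (rotate-map f k (reverse N)) (cong (rotate k) (List.reverse-map f N)))

readings-↭ : {l N : List A} → l ∈ readings N → l ↭ N
readings-↭ {N = N} l∈ with ∈-++⁻ (rotations N) l∈
... | inj₁ l∈rotations with ∈-map⁻ (flip rotate N) {xs = upTo (suc (length N))} l∈rotations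
...   | k , _ , refl = rotate-↭ k N
readings-↭ {N = N} l∈ | inj₂ l∈rotations with ∈-map⁻ (flip rotate (reverse N)) {xs = upTo (suc (length (reverse N)))} l∈rotations
...   | k , _ , refl = ↭-trans (rotate-↭ k (reverse N)) (↭-reverse N)

-- Rational literals are enabled only in this module: elsewhere they would also overload the ℕ arity
-- arguments of the ring solver.
module Coefficients where

  open import Agda.Builtin.FromNat using (Number; fromNat)
  open import Agda.Builtin.FromNeg using (Negative; fromNeg)
  open import Data.Unit using (tt)

  private
    instance
      ℚ-number : Number ℚ
      ℚ-number = ℚLiterals.number
      ℚ-negative : Negative ℚ
      ℚ-negative = ℚLiterals.negative
      ℕ-number : Number ℕ
      ℕ-number = ℕLiterals.number
      ℤ-number : Number ℤ
      ℤ-number = ℤLiterals.number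
      ℤ-negative : Negative ℤ
      ℤ-negative = ℤLiterals.negative

  -- The Kraft equalities Σ_{j ≠ i} x_ij = 8, solved for the coordinates off the free pairs.
  kraftForm : ℕ → ℕ → Affine (Fin 5)
  kraftForm 0 1 = (1 , # 0) ∷ [] ⊕ 0
  kraftForm 0 2 = (1 , # 1) ∷ [] ⊕ 0
  kraftForm 0 3 = (1 , # 2) ∷ [] ⊕ 0
  kraftForm 1 2 = (1 , # 3) ∷ [] ⊕ 0
  kraftForm 1 3 = (1 , # 4) ∷ [] ⊕ 0
  kraftForm 2 3 = (-1 , # 0) ∷ (-1 , # 1) ∷ (-1 , # 2) ∷ (-1 , # 3) ∷ (-1 , # 4) ∷ [] ⊕ 12
  kraftForm 0 4 = (-1 , # 0) ∷ (-1 , # 1) ∷ (-1 , # 2) ∷ [] ⊕ 8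
  kraftForm 1 4 = (-1 , # 0) ∷ (-1 , # 3) ∷ (-1 , # 4) ∷ [] ⊕ 8
  kraftForm 2 4 = (1 , # 0) ∷ (1 , # 2) ∷ (1 , # 4) ∷ [] ⊕ -4
  kraftForm 3 4 = (1 , # 0) ∷ (1 , # 1) ∷ (1 , # 3) ∷ [] ⊕ -4
  kraftForm _ _ = [] ⊕ 0

  basisWeights : Fin 6 → List ℚ
  basisWeights zero                               = 1 ∷ 0 ∷ 1 / 3 ∷ 1 / 3 ∷ 0 ∷ []
  basisWeights (suc zero)                         = 1 / 3 ∷ 0 ∷ 1 / 3 ∷ 0 ∷ 1 / 3 ∷ []
  basisWeights (suc (suc zero))                   = -1 / 3 ∷ 0 ∷ 1 / 3 ∷ -1 / 3 ∷ -1 / 3 ∷ []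
  basisWeights (suc (suc (suc zero)))             = -1 / 3 ∷ 1 / 3 ∷ -1 / 3 ∷ 0 ∷ 0 ∷ []
  basisWeights (suc (suc (suc (suc zero))))       = 1 / 3 ∷ -1 / 3 ∷ -2 / 3 ∷ 0 ∷ 0 ∷ []
  basisWeights (suc (suc (suc (suc (suc zero))))) = -1 ∷ 0 ∷ 0 ∷ 0 ∷ 0 ∷ []

  basisOffset : Fin 6 → ℚ
  basisOffset zero                               = -3
  basisOffset (suc zero)                         = -5 / 3
  basisOffset (suc (suc zero))                   = 5 / 3
  basisOffset (suc (suc (suc zero)))             = 2 / 3
  basisOffset (suc (suc (suc (suc zero))))       = 4 / 3
  basisOffset (suc (suc (suc (suc (suc zero))))) = 2

  vertexWeights : List ℚ
  vertexWeights = 1 / 2 ∷ -1 / 2 ∷ -1 / 2 ∷ 1 / 2 ∷ 1 / 2 ∷ []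

  vertexOffset : ℚ
  vertexOffset = -1 / 2

  -- 2 + 4 + 1 + 4 + 2 on the sides of N at a coplanar caterpillar: middle leaf to cherry, cherry, cherry to
  -- cherry, cherry, cherry to middle leaf.
  facetBound : ℚ
  facetBound = 13

open Coefficients

-- The caterpillar with cherries {p, q}, {r, s} and middle leaf m; it reads p q r s m around a circle.
caterpillar : ∀ {n} → Fin n → Fin n → Fin n → Fin n → Fin n → UTree n
caterpillar p q r s m = edge (node (leaf p) (leaf q)) (node (node (leaf r) (leaf s)) (leaf m))

-- One caterpillar for each middle leaf and each pairing of the other four leaves.
representatives : List (UTree 5)
representatives =
  caterpillar (# 1) (# 2) (# 3) (# 4) (# 0) ∷ caterpillar (# 1) (# 3) (# 2) (# 4) (# 0) ∷ caterpillar (# 1) (# 4) (# 2) (# 3) (# 0) ∷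
  caterpillar (# 0) (# 2) (# 3) (# 4) (# 1) ∷ caterpillar (# 0) (# 3) (# 2) (# 4) (# 1) ∷ caterpillar (# 0) (# 4) (# 2) (# 3) (# 1) ∷
  caterpillar (# 0) (# 1) (# 3) (# 4) (# 2) ∷ caterpillar (# 0) (# 3) (# 1) (# 4) (# 2) ∷ caterpillar (# 0) (# 4) (# 1) (# 3) (# 2) ∷
  caterpillar (# 0) (# 1) (# 2) (# 4) (# 3) ∷ caterpillar (# 0) (# 2) (# 1) (# 4) (# 3) ∷ caterpillar (# 0) (# 4) (# 1) (# 2) (# 3) ∷
  caterpillar (# 0) (# 1) (# 2) (# 3) (# 4) ∷ caterpillar (# 0) (# 2) (# 1) (# 3) (# 4) ∷ caterpillar (# 0) (# 3) (# 1) (# 2) (# 4) ∷ []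

abstract
  binaryTrees-represented : All (λ t → Any (t ≋_) representatives) (binaryTrees 4)
  binaryTrees-represented = toWitness {a? = all? (λ t → any? (t ≋?_) representatives) (binaryTrees 4)} _

represent : ∀ t → IsBinaryTree t → ∃ λ r → r ∈ representatives × t ≋ r
represent t t-binary = find (All.lookup binaryTrees-represented (∈-binaryTrees {t = t} t-binary))

free : Fin 5 → Fin 5 × Fin 5
free zero                   = # 0 , # 1
free (suc zero)             = # 0 , # 2
free (suc (suc zero))       = # 0 , # 3
free (suc (suc (suc zero))) = # 1 , # 2
free (suc (suc (suc (suc zero)))) = # 1 , # 3

SatisfiesKraft : Pt 5 → Set
SatisfiesKraft p = ∀ i j → i Fin.< j → p i j ≡ eval (kraftForm (toℕ i) (toℕ j)) (coordinates p ∘ free)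

satisfiesKraft? : ∀ p → Dec (SatisfiesKraft p)
satisfiesKraft? p = Fin.all? λ i → Fin.all? λ j → (i Fin.<? j) →-dec (p i j ℚ.≟ eval (kraftForm (toℕ i) (toℕ j)) (coordinates p ∘ free))

abstract
  representatives-kraft : All (SatisfiesKraft ∘ x) representatives
  representatives-kraft = toWitness {a? = all? (satisfiesKraft? ∘ x) representatives} _

kraft : ∀ t → IsBinaryTree t → SatisfiesKraft (x t)
kraft t t-binary i j i<j with represent t t-binary
... | r , r∈ , t≋r = begin
  x t i j                                                      ≡⟨ ≋-x t≋r i j ⟩
  x r i j                                                      ≡⟨ All.lookup representatives-kraft r∈ i j i<j ⟩
  eval (kraftForm (toℕ i) (toℕ j)) (coordinates (x r) ∘ free) ≡⟨ eval-cong (kraftForm (toℕ i) (toℕ j)) (λ p → sym (≋-x t≋r (proj₁ (free p)) (proj₂ (free p)))) ⟩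
  eval (kraftForm (toℕ i) (toℕ j)) (coordinates (x t) ∘ free) ∎

basis : Fin 6 → UTree 5
basis zero                               = caterpillar (# 1) (# 2) (# 3) (# 4) (# 0)
basis (suc zero)                         = caterpillar (# 1) (# 3) (# 2) (# 4) (# 0)
basis (suc (suc zero))                   = caterpillar (# 1) (# 4) (# 2) (# 3) (# 0)
basis (suc (suc (suc zero)))             = caterpillar (# 0) (# 2) (# 3) (# 4) (# 1)
basis (suc (suc (suc (suc zero))))       = caterpillar (# 0) (# 4) (# 2) (# 3) (# 1)
basis (suc (suc (suc (suc (suc zero))))) = caterpillar (# 0) (# 4) (# 1) (# 2) (# 3)

-- The rows of the inverse of the 6 × 6 matrix with rows (x_{free p} (basis b))_p followed by 1.
basisDual : Fin 6 → Affine (Fin 5 × Fin 5)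
basisDual a = zip (basisWeights a) (List.tabulate free) ⊕ basisOffset a

abstract
  basis-dual : IsDualBasis (x ∘ basis) basisDual
  basis-dual = toWitness {a? = isDualBasis? (x ∘ basis) basisDual} _

  basis-sorted : ∀ a → sort (leaves (basis a)) ≡ allFin 5
  basis-sorted = toWitness {a? = Fin.all? (λ a → List.≡-dec Fin._≟_ (sort (leaves (basis a))) (allFin 5))} _

basis-binary : ∀ a → IsBinaryTree (basis a)
basis-binary a = ↭-trans (↭-sym (sort-↭ (leaves (basis a)))) (↭-reflexive (basis-sorted a))

dimension-P₅ : HasDim (IsBinaryTree {5}) 5
dimension-P₅ =
  (basis , basis-binary , affinelyIndependent-dualBasis (x ∘ basis) basisDual basis-dual) ,
  λ f f-binary → ¬affinelyIndependent-parametrised free (λ i j → kraftForm (toℕ i) (toℕ j)) (x ∘ f) (λ a → kraft (f a) (f-binary a))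

sides : List A → List (A × A)
sides N = zip N (rotate 1 N)

facetNormal : List (Fin n) → Pt n
facetNormal N i j =
  if does (any? (λ (a , b) → (i Fin.≟ a ×-dec j Fin.≟ b) ⊎-dec (i Fin.≟ b ×-dec j Fin.≟ a)) (sides N)) then 1ℚ else 0ℚ

data Pentagon {A : Set} : List A → Set where
  pentagon : ∀ p q r s m → Pentagon (p ∷ q ∷ r ∷ s ∷ m ∷ [])

pentagon-view : {xs : List A} → length xs ≡ 5 → Pentagon xs
pentagon-view {xs = _ ∷ _ ∷ _ ∷ _ ∷ _ ∷ []} refl = pentagon _ _ _ _ _
pentagon-view {xs = []} ()
pentagon-view {xs = _ ∷ []} ()
pentagon-view {xs = _ ∷ _ ∷ []} ()
pentagon-view {xs = _ ∷ _ ∷ _ ∷ []} ()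
pentagon-view {xs = _ ∷ _ ∷ _ ∷ _ ∷ []} ()
pentagon-view {xs = _ ∷ _ ∷ _ ∷ _ ∷ _ ∷ _ ∷ _} ()

-- `edge (leaf 0) (leaf 0)` is a placeholder: only lists of length five are used.
caterpillarAround : List (Fin 5) → UTree 5
caterpillarAround (p ∷ q ∷ r ∷ s ∷ m ∷ _) = caterpillar p q r s m
caterpillarAround _                       = edge (leaf zero) (leaf zero)

caterpillarAround-leaves : {L : List (Fin 5)} → length L ≡ 5 → leaves (caterpillarAround L) ≡ L
caterpillarAround-leaves {L} len with pentagon-view {xs = L} len
... | pentagon _ _ _ _ _ = refl

caterpillarAround-map : (f : Fin 5 → Fin 5) {L : List (Fin 5)} → length L ≡ 5 → mapU f (caterpillarAround L) ≡ caterpillarAround (map f L)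
caterpillarAround-map f {L} len with pentagon-view {xs = L} len
... | pentagon _ _ _ _ _ = refl

-- The coplanar caterpillar whose middle leaf is the a-th entry of N.
vertex : List (Fin 5) → Fin 5 → UTree 5
vertex N a = caterpillarAround (rotate (suc (toℕ a)) N)

vertex-map : (f : Fin 5 → Fin 5) {N : List (Fin 5)} → length N ≡ 5 → ∀ a → mapU f (vertex N a) ≡ vertex (map f N) a
vertex-map f {N} len a =
  trans (caterpillarAround-map f (trans (length-rotate (suc (toℕ a)) N) len))
        (cong caterpillarAround (rotate-map f (suc (toℕ a)) N))

vertex-coplanar : {N : List (Fin 5)} → N ↭ allFin 5 → ∀ a → BinTreeCoplanar N (vertex N a)
vertex-coplanar {N} N↭ a = ↭-trans (↭-reflexive leaves≡) (↭-trans (rotate-↭ (suc (toℕ a)) N) N↭) ,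
                           coplanar-reading (vertex N a) (suc (toℕ a) , inj₁ leaves≡)
  where
  leaves≡ : leaves (vertex N a) ≡ rotate (suc (toℕ a)) N
  leaves≡ = caterpillarAround-leaves (trans (length-rotate (suc (toℕ a)) N) (length-↭allFin N↭))

indexIn : List (Fin n) → Fin n → ℕ
indexIn []       j = 0
indexIn (i ∷ is) j = if does (i Fin.≟ j) then 0 else suc (indexIn is j)

positionIn : List (Fin 5) → Fin 5 → Fin 5
positionIn N j = indexIn N j mod 5

Standardizes : List (Fin 5) → (Fin 5 → Fin 5) → Set
Standardizes N τ = (∀ i j → τ i ≡ τ j → i ≡ j) × map τ N ≡ allFin 5

FacetInequality : List (Fin 5) → UTree 5 → Set
FacetInequality N t = dot (facetNormal N) (x t) ≤ facetBound × (dot (facetNormal N) (x t) ≡ facetBound → ∃ λ a → t ≋ vertex N a)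

diagonals : List A → List (A × A)
diagonals N = zip N (rotate 2 N)

sorted : Fin n × Fin n → Fin n × Fin n
sorted (i , j) = if does (i Fin.<? j) then (i , j) else (j , i)

-- The weights sit on the diagonals of the pentagon N, counted from the one at the middle leaf of vertex N a.
vertexDual : List (Fin 5) → Fin 5 → Affine (Fin 5 × Fin 5)
vertexDual N a = zip vertexWeights (rotate (toℕ a) (map sorted (diagonals N))) ⊕ vertexOffset

abstract
  positionIn-standardizes : All (λ N → Standardizes N (positionIn N)) (permutations 5)
  positionIn-standardizes = toWitness {a? = all? (λ N →
      Fin.all? (λ i → Fin.all? (λ j → (positionIn N i Fin.≟ positionIn N j) →-dec (i Fin.≟ j))) ×-dec
      List.≡-dec Fin._≟_ (map (positionIn N) N) (allFin 5))
    (permutations 5)} _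

  facetInequality-representatives : All (λ N → All (FacetInequality N) representatives) (permutations 5)
  facetInequality-representatives = toWitness {a? = all? (λ N → all? (λ t →
      (dot (facetNormal N) (x t) ℚ.≤? facetBound) ×-dec
      ((dot (facetNormal N) (x t) ℚ.≟ facetBound) →-dec Fin.any? (λ a → t ≋? vertex N a))) representatives)
    (permutations 5)} _

  vertices-tight : All (λ N → ∀ a → dot (facetNormal N) (x (vertex N a)) ≡ facetBound) (permutations 5)
  vertices-tight = toWitness {a? = all? (λ N → Fin.all? (λ a → dot (facetNormal N) (x (vertex N a)) ℚ.≟ facetBound)) (permutations 5)} _

  vertices-dual : All (λ N → IsDualBasis (x ∘ vertex N) (vertexDual N)) (permutations 5)
  vertices-dual = toWitness {a? = all? (λ N → isDualBasis? (x ∘ vertex N) (vertexDual N)) (permutations 5)} _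

  readingTrees-vertices : All (λ t → All (λ t′ → ∃ λ a → t′ ≋ vertex (allFin 5) a) (edgeFlips t)) (treesOver (readings (allFin 5)))
  readingTrees-vertices = toWitness {a? = all? (λ t → all? (λ t′ → Fin.any? (λ a → t′ ≋? vertex (allFin 5) a)) (edgeFlips t))
    (treesOver (readings (allFin 5)))} _

module Facet {N : List (Fin 5)} (N↭ : IsCyclicOrdering N) where

  private
    N∈ : N ∈ permutations 5
    N∈ = ∈-permutations N↭

  -- Relabelling by the position in N turns N into 0 1 2 3 4: the embedded tree edge a′ b′ then lies over a
  -- reading of 0 1 2 3 4, and t is one of its flips.
  coplanar-vertex : ∀ t → BinTreeCoplanar N t → ∃ λ a → t ≋ vertex N a
  coplanar-vertex (edge a b) (_ , a′ , b′ , a~a′ , b~b′ , reads) = standardized (All.lookup positionIn-standardizes N∈)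
    where
    τ = positionIn N
    standardized : Standardizes N τ → ∃ λ v → edge a b ≋ vertex N v
    standardized (τ-injective , τN≡id) = fromIdentity (All.lookup (All.lookup readingTrees-vertices u∈) t∈)
      where
      u = mapU τ (edge a′ b′)
      u-reads : ReadsAround (leaves u) (allFin 5)
      u-reads = subst₂ ReadsAround (sym (leaves-map τ (edge a′ b′))) τN≡id (ReadsAround-map τ reads)
      u∈ : u ∈ treesOver (readings (allFin 5))
      u∈ = ∈-treesOver u (length-↭allFin (readings-↭ (∈-readings u-reads))) (∈-readings u-reads)
      t∈ : mapU τ (edge a b) ∈ edgeFlips u
      t∈ = ∈-edgeFlips (Flip-map τ (Flip-sym a~a′)) (Flip-map τ (Flip-sym b~b′))
      fromIdentity : (∃ λ v → mapU τ (edge a b) ≋ vertex (allFin 5) v) → ∃ λ v → edge a b ≋ vertex N v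
      fromIdentity (v , τt≋v) = v , ≋-unmap (λ {i} {j} → τ-injective i j)
        (subst (mapU τ (edge a b) ≋_) (trans (cong (λ M → vertex M v) (sym τN≡id)) (sym (vertex-map τ {N} (length-↭allFin N↭) v))) τt≋v)

  facetInequality : ∀ t → IsBinaryTree t → FacetInequality N t
  facetInequality t t-binary = viaRepresentative (represent t t-binary)
    where
    viaRepresentative : (∃ λ r → r ∈ representatives × t ≋ r) → FacetInequality N t
    viaRepresentative (r , r∈ , t≋r) = transfer (All.lookup (All.lookup facetInequality-representatives N∈) r∈)
      where
      dot≡ : dot (facetNormal N) (x t) ≡ dot (facetNormal N) (x r)
      dot≡ = dot-cong (facetNormal N) (≋-x t≋r)
      transfer : FacetInequality N r → FacetInequality N t
      transfer (r-below , r-tight) = subst (_≤ facetBound) (sym dot≡) r-below ,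
        λ t-tight → map₂ (≋-trans t≋r) (r-tight (trans (sym dot≡) t-tight))

  coplanar-tight : ∀ t → BinTreeCoplanar N t → dot (facetNormal N) (x t) ≡ facetBound
  coplanar-tight t t-coplanar = viaVertex (coplanar-vertex t t-coplanar)
    where
    viaVertex : (∃ λ a → t ≋ vertex N a) → dot (facetNormal N) (x t) ≡ facetBound
    viaVertex (a , t≋v) = trans (dot-cong (facetNormal N) (≋-x t≋v)) (All.lookup vertices-tight N∈ a)

  vertices-independent : AffinelyIndependent (x ∘ vertex N)
  vertices-independent = affinelyIndependent-dualBasis (x ∘ vertex N) (vertexDual N) (All.lookup vertices-dual N∈)

  dimension-facet : HasDim (BinTreeCoplanar N) 4
  dimension-facet = (vertex N , vertex-coplanar N↭ , vertices-independent) , sixDependent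
    where
    sixDependent : ∀ f → (∀ a → BinTreeCoplanar N (f a)) → ¬ AffinelyIndependent (x ∘ f)
    sixDependent f f-coplanar = repeated (Fin.pigeonhole (ℕ.n<1+n 5) (proj₁ ∘ closest))
      where
      closest : ∀ a → ∃ λ v → f a ≋ vertex N v
      closest a = coplanar-vertex (f a) (f-coplanar a)
      repeated : (∃₂ λ i j → i Fin.< j × proj₁ (closest i) ≡ proj₁ (closest j)) → ¬ AffinelyIndependent (x ∘ f)
      repeated (i , j , i<j , same-vertex) = ¬affinelyIndependent-repeated (x ∘ f) (Fin.<⇒≢ i<j) λ k l _ →
        trans (≋-x (proj₂ (closest i)) k l) (trans (cong (λ v → x (vertex N v) k l) same-vertex) (sym (≋-x (proj₂ (closest j)) k l)))

theorem5 : (N : List (Fin 5)) → IsCyclicOrdering N →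
    -- the convex hull F of the coplanar trees is a face of P_5:
    -- cut out by a valid inequality  dot c x ≤ b  of P_5
    (Σ (Pt 5) λ c → Σ ℚ λ b →
      (∀ t → IsBinaryTree t → dot c (x t) ≤ b)
      × (∀ t → BinTreeCoplanar N t → dot c (x t) ≡ b)
      × (∀ t → IsBinaryTree t → dot c (x t) ≡ b → InConvOf (BinTreeCoplanar N) (x t)))
    -- of codimension one
    × (Σ ℕ λ d → HasDim (BinTreeCoplanar N) d × HasDim (IsBinaryTree {5}) (suc d))
    -- and F is a 4-simplex: exactly five distinct vertices, affinely independent
    × (Σ (Fin 5 → UTree 5) λ f →
        (∀ a → BinTreeCoplanar N (f a))
        × (∀ a a' → x (f a) ≈P x (f a') → a ≡ a')
        × (∀ t → BinTreeCoplanar N t → Σ (Fin 5) λ a → x t ≈P x (f a))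
        × AffinelyIndependent {5} {5} (λ a → x (f a)))
theorem5 N N-cyclic =
  (facetNormal N , facetBound , (λ t t-binary → proj₁ (facetInequality t t-binary)) , coplanar-tight , tight-inHull) ,
  (4 , dimension-facet , dimension-P₅) ,
  (vertex N , vertex-coplanar N-cyclic , affinelyIndependent-injective (x ∘ vertex N) vertices-independent ,
   (λ t t-coplanar → map₂ ≋⇒≈P (coplanar-vertex t t-coplanar)) , vertices-independent)
  where
  open Facet N-cyclic
  tight-inHull : ∀ t → IsBinaryTree t → dot (facetNormal N) (x t) ≡ facetBound → InConvOf (BinTreeCoplanar N) (x t)
  tight-inHull t t-binary tight =
    uncurry (λ a t≋v → inConvOf-member (BinTreeCoplanar N) (vertex-coplanar N-cyclic a) (≋⇒≈P t≋v)) (proj₂ (facetInequality t t-binary) tight)
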